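{- Let $F(\mathbf{X},\mathbf{Y})$ be a Boolean specification, and let $(\mathbf{T},\mathsf{Fun}_{\mathbf{T}})$ and $(\mathbf{T}',\mathsf{Fun}_{\mathbf{T}'})$ be acyclic systems of functional definitions in $F$, where $\mathbf{T}'\subseteq\mathbf{T}\subseteq\mathbf{X}$ and $\mathsf{Fun}_{\mathbf{T}}\equiv\mathsf{Fun}_{\mathbf{T}'}\wedge\mathsf{Fun}_{\mathbf{T}\setminus\mathbf{T}'}$. Let $x_i\in\mathbf{X}\setminus\mathbf{T}$ and $a\in\{0,1\}$. If $\theta_{F,\mathbf{T}',x_i,a}$ is a tautology, then so is $\theta_{F,\mathbf{T},x_i,a}$.
   Context: An output $x_j$ is functionally determined in $F$ with functional definition (f-def) $x_j\Leftrightarrow g_j$, where $g_j$ is a formula over variables of $\mathbf{X}\cup\mathbf{Y}$ other than $x_j$, if $F\Rightarrow(x_j\Leftrightarrow g_j)$ is valid. For $\mathbf{T}\subseteq\mathbf{X}$ a set of such variables, $\mathsf{Fun}_{\mathbf{T}}$ is the conjunction of one f-def for each variable in $\mathbf{T}$ (and $\mathsf{Fun}_{\mathbf{T}\setminus\mathbf{T}'}$ the conjunction of those for variables in $\mathbf{T}\setminus\mathbf{T}'$); $(\mathbf{T},\mathsf{Fun}_{\mathbf{T}})$ is acyclic if no variable of $\mathbf{T}$ transitively depends on itself via these f-defs. For $x_i\in\mathbf{X}\setminus\mathbf{T}$, $a\in\{0,1\}$, fresh $\mathbf{X}'=(x_1',\ldots,x_n')$, and $\mathsf{Fun}_{\mathbf{T}}(\mathbf{X}',\mathbf{Y})$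 the renaming of $\mathsf{Fun}_{\mathbf{T}}$ with $x_j\mapsto x_j'$: $$\theta_{F,\mathbf{T},x_i,a}:=\Big(F(\mathbf{X},\mathbf{Y})|_{x_i=a}\wedge\bigwedge_{x_j\in\mathbf{X}\setminus(\mathbf{T}\cup\{x_i\})}(x_j\Leftrightarrow x_j')\wedge\mathsf{Fun}_{\mathbf{T}}(\mathbf{X}',\mathbf{Y})|_{x_i'=1-a}\Big)\Rightarrow F(\mathbf{X}',\mathbf{Y})|_{x_i'=1-a},$$ and similarly for $\mathbf{T}'$. $F|_{z=a}$ denotes $F$ with $z$ set to $a$. -}

module Defs where

open import Data.Bool using (Bool; true; false; not; if_then_else_; _∧_; _∨_)
open import Data.Fin using (Fin; _≟_)
open import Data.Nat using (ℕ)
open import Data.List using (List; []; _∷_; _++_; concatMap; allFin)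
open import Data.Sum using (_⊎_; inj₁; inj₂)
open import Data.Product using (_×_)
open import Data.List.Membership.Propositional using (_∈_)
open import Relation.Nullary using (¬_; does)
open import Relation.Binary.PropositionalEquality using (_≡_)
open import Relation.Binary.Construct.Closure.Transitive using (TransClosure)

data Formula (V : Set) : Set where
  var  : V → Formula V
  cst  : Bool → Formula V
  ¬'_  : Formula V → Formula V
  _∧'_ : Formula V → Formula V → Formula V
  _∨'_ : Formula V → Formula V → Formula V
  _⇒'_ : Formula V → Formula V → Formula V
  _⇔'_ : Formula V → Formula V → Formula V

infixr 6 _∧'_
infixr 5 _∨'_
infixr 4 _⇒'_ _⇔'_

_⇒ᵇ_ : Bool → Bool → Bool
true ⇒ᵇ b = b
false ⇒ᵇ b = true

_⇔ᵇ_ : Bool → Bool → Bool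
true ⇔ᵇ b = b
false ⇔ᵇ b = not b

eval : {V : Set} → (V → Bool) → Formula V → Bool
eval ρ (var v)   = ρ v
eval ρ (cst b)   = b
eval ρ (¬' φ)    = not (eval ρ φ)
eval ρ (φ ∧' ψ)  = eval ρ φ ∧ eval ρ ψ
eval ρ (φ ∨' ψ)  = eval ρ φ ∨ eval ρ ψ
eval ρ (φ ⇒' ψ)  = eval ρ φ ⇒ᵇ eval ρ ψ
eval ρ (φ ⇔' ψ)  = eval ρ φ ⇔ᵇ eval ρ ψ

Tautology : {V : Set} → Formula V → Set
Tautology {V} φ = (ρ : V → Bool) → eval ρ φ ≡ true

subst : {V W : Set} → (V → Formula W) → Formula V → Formula W
subst σ (var v)  = σ v
subst σ (cst b)  = cst b
subst σ (¬' φ)   = ¬' subst σ φ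
subst σ (φ ∧' ψ) = subst σ φ ∧' subst σ ψ
subst σ (φ ∨' ψ) = subst σ φ ∨' subst σ ψ
subst σ (φ ⇒' ψ) = subst σ φ ⇒' subst σ ψ
subst σ (φ ⇔' ψ) = subst σ φ ⇔' subst σ ψ

vars : {V : Set} → Formula V → List V
vars (var v)  = v ∷ []
vars (cst b)  = []
vars (¬' φ)   = vars φ
vars (φ ∧' ψ) = vars φ ++ vars ψ
vars (φ ∨' ψ) = vars φ ++ vars ψ
vars (φ ⇒' ψ) = vars φ ++ vars ψ
vars (φ ⇔' ψ) = vars φ ++ vars ψ

⋀ : {V : Set} → List (Formula V) → Formula V
⋀ []       = cst true
⋀ (φ ∷ φs) = φ ∧' ⋀ φs

-- variables of F : inj₁ j is the output x_j, inj₂ k is the input y_k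
Var : ℕ → ℕ → Set
Var n m = Fin n ⊎ Fin m

data TVar (n m : ℕ) : Set where
  x  : Fin n → TVar n m
  x' : Fin n → TVar n m
  y  : Fin m → TVar n m

SubsetX : ℕ → Set
SubsetX n = Fin n → Bool

_∈ₛ_ : {n : ℕ} → Fin n → SubsetX n → Set
j ∈ₛ T = T j ≡ true

-- a family of candidate definitions g_j (only those for j ∈ T are used)
Defns : ℕ → ℕ → Set
Defns n m = Fin n → Formula (Var n m)

IsFunDefs : {n m : ℕ} → Formula (Var n m) → SubsetX n → Defns n m → Set
IsFunDefs F T g = ∀ j → j ∈ₛ T →
  (¬ (inj₁ j ∈ vars (g j))) × Tautology (F ⇒' (var (inj₁ j) ⇔' g j))

DependsOn : {n m : ℕ} → SubsetX n → Defns n m → Fin n → Fin n → Set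
DependsOn T g j k = j ∈ₛ T × k ∈ₛ T × inj₁ k ∈ vars (g j)

Acyclic : {n m : ℕ} → SubsetX n → Defns n m → Set
Acyclic T g = ∀ j → ¬ TransClosure (DependsOn T g) j j

onX : {n m : ℕ} → Var n m → Formula (TVar n m)
onX (inj₁ j) = var (x j)
onX (inj₂ k) = var (y k)

onX' : {n m : ℕ} → Var n m → Formula (TVar n m)
onX' (inj₁ j) = var (x' j)
onX' (inj₂ k) = var (y k)

restrictX : {n m : ℕ} → Fin n → Bool → Formula (TVar n m) → Formula (TVar n m)
restrictX i a = subst σ
  where
  σ : _ → _
  σ (x j)  = if does (j ≟ i) then cst a else var (x j)
  σ (x' j) = var (x' j)
  σ (y k)  = var (y k)

restrictX' : {n m : ℕ} → Fin n → Bool → Formula (TVar n m) → Formula (TVar n m)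
restrictX' i a = subst σ
  where
  σ : _ → _
  σ (x j)  = var (x j)
  σ (x' j) = if does (j ≟ i) then cst a else var (x' j)
  σ (y k)  = var (y k)

FunX' : {n m : ℕ} → SubsetX n → Defns n m → Formula (TVar n m)
FunX' {n} T g =
  ⋀ (concatMap (λ j → if T j then (var (x' j) ⇔' subst onX' (g j)) ∷ [] else [])
               (allFin n))

Frame : {n m : ℕ} → SubsetX n → Fin n → Formula (TVar n m)
Frame {n} T i =
  ⋀ (concatMap (λ j → if (T j ∨ does (j ≟ i)) then [] else (var (x j) ⇔' var (x' j)) ∷ [])
               (allFin n))

θ : {n m : ℕ} → Formula (Var n m) → SubsetX n → Defns n m → Fin n → Bool
  → Formula (TVar n m)
θ F T g i a =
  (restrictX i a (subst onX F) ∧' Frame T i ∧' restrictX' i (not a) (FunX' T g))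
  ⇒' restrictX' i (not a) (subst onX' F)

module Submission where

-- Take values of X, X', Y satisfying the premises of θ_{F,T,x_i,a}. Keep X and Y, and recompute
-- X' by solving the acyclic definitions of T' from the frame values (x_i' = ¬a, x_j' = x_j
-- elsewhere on X ∖ T'); the new values satisfy the premises of θ_{F,T',x_i,a}, so F holds on
-- them. F then forces all the definitions of T. Acyclic definitions have exactly one solution
-- with prescribed values outside T (well-founded recursion along the dependency order), and the
-- given X' is such a solution with the same values outside T as the new one, so the two coincide
-- and F holds on the given X'.

open import Defs
open import Data.Nat using (ℕ)
open import Data.Bool using (Bool; true; false; not; if_then_else_; _∧_; _∨_)
open import Data.Bool.Properties using (if-float; if-cong; not-¬; ¬-not) renaming (_≟_ to _≟ᵇ_)
open import Data.Fin using (Fin; _≟_)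
open import Data.Fin.Induction using (spo-noetherian)
open import Data.List using (List; []; _∷_; concatMap; allFin)
open import Data.List.Membership.DecPropositional using (_∈?_)
open import Data.List.Membership.Propositional using (_∈_)
open import Data.List.Membership.Propositional.Properties using (∈-++⁺ˡ; ∈-++⁺ʳ)
open import Data.List.Relation.Unary.All using (All; []; _∷_)
open import Data.List.Relation.Unary.All.Properties using (concat⁺; concat⁻; map⁺; map⁻; tabulate⁺; tabulate⁻)
open import Data.List.Relation.Unary.Any using (here)
open import Data.Product using (Σ-syntax; _×_; _,_; proj₁; proj₂)
open import Data.Sum using (inj₁; inj₂; [_,_]′)
open import Data.Sum.Properties using (≡-dec)
open import Function using (flip; _∘_)
open import Function.Bundles using (_⇔_; mk⇔; Equivalence)
open import Induction.WellFounded using (WellFounded; WfRec; module All; module FixPoint; module Subrelation)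
open import Relation.Binary.Core using (Rel)
open import Relation.Binary.Definitions using (Decidable)
open import Relation.Binary.Structures using (IsStrictPartialOrder)
open import Relation.Binary.Construct.Closure.Transitive using (TransClosure; [_]; _∷_; _++_)
open import Relation.Binary.PropositionalEquality
  using (_≡_; _≢_; _≗_; module ≡-Reasoning; refl; sym; trans; cong; cong₂; resp₂; isEquivalence)
  renaming (subst to transport)
open import Relation.Nullary using (¬_; yes; no; does; contradiction)
open import Relation.Nullary.Decidable using (_×-dec_)

open Equivalence using (to; from)

∧-true : ∀ {p q} → p ∧ q ≡ true ⇔ (p ≡ true × q ≡ true)
∧-true {true} = mk⇔ (refl ,_) proj₂
∧-true {false} = mk⇔ (λ ()) (λ ())

⇒ᵇ-true : ∀ {p q} → p ⇒ᵇ q ≡ true ⇔ (p ≡ true → q ≡ true)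
⇒ᵇ-true {true} = mk⇔ (λ q _ → q) (λ f → f refl)
⇒ᵇ-true {false} = mk⇔ (λ _ ()) (λ _ → refl)

⇔ᵇ-true : ∀ {p q} → p ⇔ᵇ q ≡ true ⇔ p ≡ q
⇔ᵇ-true {true} = mk⇔ sym sym
⇔ᵇ-true {false} {true} = mk⇔ (λ ()) (λ ())
⇔ᵇ-true {false} {false} = mk⇔ (λ _ → refl) (λ _ → refl)

module _ {V : Set} where

  eval-cong : (ρ ρ' : V → Bool) (φ : Formula V) →
              (∀ v → v ∈ vars φ → ρ v ≡ ρ' v) → eval ρ φ ≡ eval ρ' φ
  eval-cong ρ ρ' (var v) agree = agree v (here refl)
  eval-cong ρ ρ' (cst b) agree = refl
  eval-cong ρ ρ' (¬' φ) agree = cong not (eval-cong ρ ρ' φ agree)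
  eval-cong ρ ρ' (φ ∧' ψ) agree = cong₂ _∧_
    (eval-cong ρ ρ' φ (λ v → agree v ∘ ∈-++⁺ˡ))
    (eval-cong ρ ρ' ψ (λ v → agree v ∘ ∈-++⁺ʳ (vars φ)))
  eval-cong ρ ρ' (φ ∨' ψ) agree = cong₂ _∨_
    (eval-cong ρ ρ' φ (λ v → agree v ∘ ∈-++⁺ˡ))
    (eval-cong ρ ρ' ψ (λ v → agree v ∘ ∈-++⁺ʳ (vars φ)))
  eval-cong ρ ρ' (φ ⇒' ψ) agree = cong₂ _⇒ᵇ_
    (eval-cong ρ ρ' φ (λ v → agree v ∘ ∈-++⁺ˡ))
    (eval-cong ρ ρ' ψ (λ v → agree v ∘ ∈-++⁺ʳ (vars φ)))
  eval-cong ρ ρ' (φ ⇔' ψ) agree = cong₂ _⇔ᵇ_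
    (eval-cong ρ ρ' φ (λ v → agree v ∘ ∈-++⁺ˡ))
    (eval-cong ρ ρ' ψ (λ v → agree v ∘ ∈-++⁺ʳ (vars φ)))

  eval-ext : {ρ ρ' : V → Bool} (φ : Formula V) → ρ ≗ ρ' → eval ρ φ ≡ eval ρ' φ
  eval-ext {ρ} {ρ'} φ ρ≗ρ' = eval-cong ρ ρ' φ (λ v _ → ρ≗ρ' v)

  eval-⋀ : {ρ : V → Bool} {φs : List (Formula V)} →
           eval ρ (⋀ φs) ≡ true ⇔ All (λ φ → eval ρ φ ≡ true) φs
  eval-⋀ {φs = []} = mk⇔ (λ _ → []) (λ _ → refl)
  eval-⋀ {φs = φ ∷ φs} = mk⇔
    (λ holds → let (φ-holds , φs-hold) = to ∧-true holds in φ-holds ∷ to eval-⋀ φs-hold)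
    (λ { (φ-holds ∷ φs-hold) → from ∧-true (φ-holds , from eval-⋀ φs-hold) })

eval-subst : {V W : Set} (ρ : W → Bool) (σ : V → Formula W) (φ : Formula V) →
             eval ρ (subst σ φ) ≡ eval (eval ρ ∘ σ) φ
eval-subst ρ σ (var v) = refl
eval-subst ρ σ (cst b) = refl
eval-subst ρ σ (¬' φ) = cong not (eval-subst ρ σ φ)
eval-subst ρ σ (φ ∧' ψ) = cong₂ _∧_ (eval-subst ρ σ φ) (eval-subst ρ σ ψ)
eval-subst ρ σ (φ ∨' ψ) = cong₂ _∨_ (eval-subst ρ σ φ) (eval-subst ρ σ ψ)
eval-subst ρ σ (φ ⇒' ψ) = cong₂ _⇒ᵇ_ (eval-subst ρ σ φ) (eval-subst ρ σ ψ)
eval-subst ρ σ (φ ⇔' ψ) = cong₂ _⇔ᵇ_ (eval-subst ρ σ φ) (eval-subst ρ σ ψ)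

All-concatMap-allFin : {A : Set} {P : A → Set} {n : ℕ} {f : Fin n → List A} →
                       All P (concatMap f (allFin n)) ⇔ (∀ j → All P (f j))
All-concatMap-allFin = mk⇔ (tabulate⁻ ∘ map⁻ ∘ concat⁻) (concat⁺ ∘ map⁺ ∘ tabulate⁺)

acyclic⇒wellFounded : ∀ {n ℓ} {D : Rel (Fin n) ℓ} →
                      (∀ j → ¬ TransClosure D j j) → WellFounded (flip D)
acyclic⇒wellFounded {D = D} acyclic =
  Subrelation.wellFounded [_] (spo-noetherian D⁺-isStrictPartialOrder)
  where
  D⁺-isStrictPartialOrder : IsStrictPartialOrder _≡_ (TransClosure D)
  D⁺-isStrictPartialOrder = record
    { isEquivalence = isEquivalence
    ; irrefl = λ { refl → acyclic _ }
    ; trans = _++_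
    ; <-resp-≈ = resp₂ _
    }

module LocalFixpoint {a b ℓ} {A : Set a} {B : Set b} {_⊏_ : Rel A ℓ} (wf : WellFounded _⊏_)
  (Φ : (A → B) → A → B)
  (Φ-local : ∀ {v w} j → (∀ {k} → k ⊏ j → v k ≡ w k) → Φ v j ≡ Φ w j) where

  fixpoint-unique : {v w : A → B} → (∀ j → v j ≡ Φ v j) → (∀ j → w j ≡ Φ w j) → v ≗ w
  fixpoint-unique {v} {w} v-fix w-fix = All.wfRec wf _ (λ j → v j ≡ w j)
    λ j IH → trans (v-fix j) (trans (Φ-local j IH) (sym (w-fix j)))

  -- b₀ fills the arguments Φ never looks at.
  module _ (_⊏?_ : Decidable _⊏_) (b₀ : B) where

    private
      extend : ∀ j → WfRec _⊏_ (λ _ → B) j → A → B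
      extend j IH k with k ⊏? j
      ... | yes k⊏j = IH k⊏j
      ... | no _ = b₀

      Φ-wfRec : ∀ j → WfRec _⊏_ (λ _ → B) j → B
      Φ-wfRec j IH = Φ (extend j IH) j

      extend-cong : ∀ j {IH IH′ : WfRec _⊏_ (λ _ → B) j} →
                    (∀ {k} (k⊏j : k ⊏ j) → IH k⊏j ≡ IH′ k⊏j) →
                    ∀ {k} → k ⊏ j → extend j IH k ≡ extend j IH′ k
      extend-cong j IH≗IH′ {k} _ with k ⊏? j
      ... | yes k⊏j = IH≗IH′ k⊏j
      ... | no _ = refl

    open FixPoint wf (λ _ → B) Φ-wfRec (λ j IH≗IH′ → Φ-local j (extend-cong j IH≗IH′))
      using (unfold-wfRec)

    fixpoint : A → B
    fixpoint = All.wfRec wf _ (λ _ → B) Φ-wfRec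

    fixpoint-unfold : ∀ j → fixpoint j ≡ Φ fixpoint j
    fixpoint-unfold j = trans unfold-wfRec (Φ-local j extend-fixpoint)
      where
      extend-fixpoint : ∀ {k} → k ⊏ j → extend j (λ _ → fixpoint _) k ≡ fixpoint k
      extend-fixpoint {k} k⊏j with k ⊏? j
      ... | yes _ = refl
      ... | no k⋢j = contradiction k⊏j k⋢j

module _ {n m : ℕ} (T : SubsetX n) (g : Defns n m) where

  Uses : Fin n → Fin n → Set
  Uses j k = j ∈ₛ T × inj₁ k ∈ vars (g j)

  uses? : Decidable Uses
  uses? j k = (T j ≟ᵇ true) ×-dec (_∈?_ (≡-dec _≟_ _≟_) (inj₁ k) (vars (g j)))

  uses⁺-source : ∀ {j k} → TransClosure Uses j k → j ∈ₛ T
  uses⁺-source [ (j∈T , _) ] = j∈T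
  uses⁺-source ((j∈T , _) ∷ _) = j∈T

  uses⁺⇒dependsOn⁺ : ∀ {j k} → TransClosure Uses j k → k ∈ₛ T → TransClosure (DependsOn T g) j k
  uses⁺⇒dependsOn⁺ [ (j∈T , k∈gⱼ) ] k∈T = [ (j∈T , k∈T , k∈gⱼ) ]
  uses⁺⇒dependsOn⁺ ((j∈T , l∈gⱼ) ∷ l⁺k) k∈T =
    (j∈T , uses⁺-source l⁺k , l∈gⱼ) ∷ uses⁺⇒dependsOn⁺ l⁺k k∈T

  uses-wellFounded : Acyclic T g → WellFounded (flip Uses)
  uses-wellFounded acyclic = acyclic⇒wellFounded λ j cycle →
    acyclic j (uses⁺⇒dependsOn⁺ cycle (uses⁺-source cycle))

  SatisfiesDefs : (Fin n → Bool) → (Fin m → Bool) → Set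
  SatisfiesDefs u w = ∀ j → j ∈ₛ T → u j ≡ eval [ u , w ]′ (g j)

  SatisfiesDefs-resp : ∀ {u u' w} → u ≗ u' → SatisfiesDefs u w → SatisfiesDefs u' w
  SatisfiesDefs-resp u≗u' sat j j∈T =
    trans (sym (u≗u' j))
          (trans (sat j j∈T) (eval-ext (g j) λ { (inj₁ k) → u≗u' k ; (inj₂ _) → refl }))

  isFunDefs⇒satisfiesDefs : ∀ {F u w} → IsFunDefs F T g →
                            eval [ u , w ]′ F ≡ true → SatisfiesDefs u w
  isFunDefs⇒satisfiesDefs fd F-holds j j∈T =
    to ⇔ᵇ-true (to ⇒ᵇ-true (proj₂ (fd j j∈T) _) F-holds)

  defStep : (Fin n → Bool) → (Fin m → Bool) → (Fin n → Bool) → Fin n → Bool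
  defStep c w u j = if T j then eval [ u , w ]′ (g j) else c j

  defStep-local : ∀ c w {u u'} j → (∀ {k} → Uses j k → u k ≡ u' k) →
                  defStep c w u j ≡ defStep c w u' j
  defStep-local c w j agree with T j
  ... | true = eval-cong _ _ (g j) λ { (inj₁ k) k∈gⱼ → agree (refl , k∈gⱼ) ; (inj₂ _) _ → refl }
  ... | false = refl

  solution⇒fixpoint : ∀ {c u w} → SatisfiesDefs u w → (∀ j → ¬ j ∈ₛ T → u j ≡ c j) →
                      ∀ j → u j ≡ defStep c w u j
  solution⇒fixpoint sat off j with T j in j∈T
  ... | true = sat j j∈T
  ... | false = off j (not-¬ j∈T)

  solution-exists : Acyclic T g → (c : Fin n → Bool) (w : Fin m → Bool) →
             Σ[ u ∈ (Fin n → Bool) ] SatisfiesDefs u w × (∀ j → ¬ j ∈ₛ T → u j ≡ c j)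
  solution-exists acyclic c w =
      fixpoint (flip uses?) false
    , (λ j j∈T → trans (fixpoint-unfold (flip uses?) false j) (if-cong j∈T))
    , (λ j j∉T → trans (fixpoint-unfold (flip uses?) false j) (if-cong (¬-not j∉T)))
    where open LocalFixpoint (uses-wellFounded acyclic) (defStep c w) (defStep-local c w)

  solution-unique : Acyclic T g → ∀ {u u' w} → SatisfiesDefs u w → SatisfiesDefs u' w →
                    (∀ j → ¬ j ∈ₛ T → u j ≡ u' j) → u ≗ u'
  solution-unique acyclic {u} {w = w} sat sat' agree =
    fixpoint-unique (solution⇒fixpoint sat λ _ _ → refl)
                    (solution⇒fixpoint sat' λ j j∉T → sym (agree j j∉T))
    where open LocalFixpoint (uses-wellFounded acyclic) (defStep u w) (defStep-local u w)

module _ {n m : ℕ} where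

  _[_]≔_ : (Fin n → Bool) → Fin n → Bool → Fin n → Bool
  (u [ i ]≔ a) j = if does (j ≟ i) then a else u j

  []≔-same : ∀ u i a → (u [ i ]≔ a) i ≡ a
  []≔-same u i a with i ≟ i
  ... | yes _ = refl
  ... | no i≢i = contradiction refl i≢i

  []≔-other : ∀ u {i j} a → j ≢ i → (u [ i ]≔ a) j ≡ u j
  []≔-other u {i} {j} a j≢i with j ≟ i
  ... | yes j≡i = contradiction j≡i j≢i
  ... | no _ = refl

  []≔-cong : ∀ u v {i j} a → (j ≢ i → u j ≡ v j) → (u [ i ]≔ a) j ≡ (v [ i ]≔ a) j
  []≔-cong u v {i} {j} a agree with j ≟ i
  ... | yes _ = refl
  ... | no j≢i = agree j≢i

  []≔-self : ∀ {u i a} → u i ≡ a → u [ i ]≔ a ≗ u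
  []≔-self {i = i} uᵢ≡a j with j ≟ i
  ... | yes refl = sym uᵢ≡a
  ... | no _ = refl

  ⟨_,_,_⟩ : (Fin n → Bool) → (Fin n → Bool) → (Fin m → Bool) → TVar n m → Bool
  ⟨ u , u' , w ⟩ (x j) = u j
  ⟨ u , u' , w ⟩ (x' j) = u' j
  ⟨ u , u' , w ⟩ (y k) = w k

  eval-onX : (ρ : TVar n m → Bool) (φ : Formula (Var n m)) →
             eval ρ (subst onX φ) ≡ eval [ ρ ∘ x , ρ ∘ y ]′ φ
  eval-onX ρ φ = trans (eval-subst ρ onX φ) (eval-ext φ λ { (inj₁ _) → refl ; (inj₂ _) → refl })

  eval-onX' : (ρ : TVar n m → Bool) (φ : Formula (Var n m)) →
              eval ρ (subst onX' φ) ≡ eval [ ρ ∘ x' , ρ ∘ y ]′ φ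
  eval-onX' ρ φ = trans (eval-subst ρ onX' φ) (eval-ext φ λ { (inj₁ _) → refl ; (inj₂ _) → refl })

  eval-restrictX : ∀ i a (ρ : TVar n m → Bool) φ →
                   eval ρ (restrictX i a φ) ≡ eval ⟨ (ρ ∘ x) [ i ]≔ a , ρ ∘ x' , ρ ∘ y ⟩ φ
  eval-restrictX i a ρ φ = trans (eval-subst ρ _ φ) (eval-ext φ
    λ { (x j) → if-float (eval ρ) (does (j ≟ i)) ; (x' _) → refl ; (y _) → refl })

  eval-restrictX' : ∀ i a (ρ : TVar n m → Bool) φ →
                    eval ρ (restrictX' i a φ) ≡ eval ⟨ ρ ∘ x , (ρ ∘ x') [ i ]≔ a , ρ ∘ y ⟩ φ
  eval-restrictX' i a ρ φ = trans (eval-subst ρ _ φ) (eval-ext φ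
    λ { (x _) → refl ; (x' j) → if-float (eval ρ) (does (j ≟ i)) ; (y _) → refl })

  eval-Frame : ∀ T i (ρ : TVar n m → Bool) →
               eval ρ (Frame T i) ≡ true ⇔ (∀ j → ¬ j ∈ₛ T → j ≢ i → ρ (x j) ≡ ρ (x' j))
  eval-Frame T i ρ = mk⇔
    (λ holds j → to (entry j) (to All-concatMap-allFin (to eval-⋀ holds) j))
    (λ agree → from eval-⋀ (from All-concatMap-allFin λ j → from (entry j) (agree j)))
    where
    entry : ∀ j → All (λ φ → eval ρ φ ≡ true)
                      (if T j ∨ does (j ≟ i) then [] else (var (x j) ⇔' var (x' j)) ∷ [])
                  ⇔ (¬ j ∈ₛ T → j ≢ i → ρ (x j) ≡ ρ (x' j))
    entry j with T j | j ≟ i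
    ... | true | _ = mk⇔ (λ _ j∉T → contradiction refl j∉T) (λ _ → [])
    ... | false | yes j≡i = mk⇔ (λ _ _ j≢i → contradiction j≡i j≢i) (λ _ → [])
    ... | false | no j≢i = mk⇔ (λ { (holds ∷ []) _ _ → to ⇔ᵇ-true holds })
                                (λ agree → from ⇔ᵇ-true (agree (λ ()) j≢i) ∷ [])

  eval-FunX' : ∀ T g (ρ : TVar n m → Bool) →
               eval ρ (FunX' T g) ≡ true ⇔ SatisfiesDefs T g (ρ ∘ x') (ρ ∘ y)
  eval-FunX' T g ρ = mk⇔
    (λ holds j → to (entry j) (to All-concatMap-allFin (to eval-⋀ holds) j))
    (λ sat → from eval-⋀ (from All-concatMap-allFin λ j → from (entry j) (sat j)))
    where
    entry : ∀ j → All (λ φ → eval ρ φ ≡ true)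
                      (if T j then (var (x' j) ⇔' subst onX' (g j)) ∷ [] else [])
                  ⇔ (j ∈ₛ T → ρ (x' j) ≡ eval [ ρ ∘ x' , ρ ∘ y ]′ (g j))
    entry j with T j
    ... | true = mk⇔ (λ { (holds ∷ []) _ → trans (to ⇔ᵇ-true holds) (eval-onX' ρ (g j)) })
                     (λ def → from ⇔ᵇ-true (trans (def refl) (sym (eval-onX' ρ (g j)))) ∷ [])
    ... | false = mk⇔ (λ _ ()) (λ _ → [])

  eval-restrictX-onX : ∀ i a (ρ : TVar n m → Bool) φ →
                       eval ρ (restrictX i a (subst onX φ)) ≡ eval [ (ρ ∘ x) [ i ]≔ a , ρ ∘ y ]′ φ
  eval-restrictX-onX i a ρ φ = trans (eval-restrictX i a ρ (subst onX φ)) (eval-onX _ φ)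

  eval-restrictX'-onX' : ∀ i a (ρ : TVar n m → Bool) φ →
                         eval ρ (restrictX' i a (subst onX' φ)) ≡
                         eval [ (ρ ∘ x') [ i ]≔ a , ρ ∘ y ]′ φ
  eval-restrictX'-onX' i a ρ φ = trans (eval-restrictX' i a ρ (subst onX' φ)) (eval-onX' _ φ)

  eval-restrictX'-FunX' : ∀ i a T g (ρ : TVar n m → Bool) →
                          eval ρ (restrictX' i a (FunX' T g)) ≡ true ⇔
                          SatisfiesDefs T g ((ρ ∘ x') [ i ]≔ a) (ρ ∘ y)
  eval-restrictX'-FunX' i a T g ρ =
    transport (λ b → b ≡ true ⇔ SatisfiesDefs T g ((ρ ∘ x') [ i ]≔ a) (ρ ∘ y))
              (sym (eval-restrictX' i a ρ (FunX' T g)))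
              (eval-FunX' T g ⟨ ρ ∘ x , (ρ ∘ x') [ i ]≔ a , ρ ∘ y ⟩)

  Θ : Formula (Var n m) → SubsetX n → Defns n m → Fin n → Bool →
      (Fin n → Bool) → (Fin n → Bool) → (Fin m → Bool) → Set
  Θ F T g i a u u' w =
    eval [ u [ i ]≔ a , w ]′ F ≡ true →
    (∀ j → ¬ j ∈ₛ T → j ≢ i → u j ≡ u' j) →
    SatisfiesDefs T g (u' [ i ]≔ not a) w →
    eval [ u' [ i ]≔ not a , w ]′ F ≡ true

  eval-θ : ∀ F T g i a (ρ : TVar n m → Bool) →
           eval ρ (θ F T g i a) ≡ true ⇔ Θ F T g i a (ρ ∘ x) (ρ ∘ x') (ρ ∘ y)
  eval-θ F T g i a ρ = mk⇔
    (λ holds F-holds frame sat → trans (sym after) (to ⇒ᵇ-true holds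
      (from ∧-true (trans before F-holds , from ∧-true (from frame⇔ frame , from fun⇔ sat)))))
    (λ Θ-holds → from ⇒ᵇ-true λ premises →
      let (F-holds , rest) = to ∧-true premises
          (frame , fun) = to ∧-true rest
      in trans after (Θ-holds (trans (sym before) F-holds) (to frame⇔ frame) (to fun⇔ fun)))
    where
    before : eval ρ (restrictX i a (subst onX F)) ≡ eval [ (ρ ∘ x) [ i ]≔ a , ρ ∘ y ]′ F
    before = eval-restrictX-onX i a ρ F
    after : eval ρ (restrictX' i (not a) (subst onX' F)) ≡
            eval [ (ρ ∘ x') [ i ]≔ not a , ρ ∘ y ]′ F
    after = eval-restrictX'-onX' i (not a) ρ F
    frame⇔ : eval ρ (Frame T i) ≡ true ⇔ (∀ j → ¬ j ∈ₛ T → j ≢ i → ρ (x j) ≡ ρ (x' j))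
    frame⇔ = eval-Frame T i ρ
    fun⇔ : eval ρ (restrictX' i (not a) (FunX' T g)) ≡ true ⇔
           SatisfiesDefs T g ((ρ ∘ x') [ i ]≔ not a) (ρ ∘ y)
    fun⇔ = eval-restrictX'-FunX' i (not a) T g ρ

  Θ-from-subsystem : ∀ F T T' g i a {u u' w} → IsFunDefs F T g → Acyclic T g → Acyclic T' g →
                     (∀ j → j ∈ₛ T' → j ∈ₛ T) → ¬ i ∈ₛ T →
                     (∀ v → Θ F T' g i a u v w) → Θ F T g i a u u' w
  Θ-from-subsystem F T T' g i a {u} {u'} {w} fd acyclic acyclic' T'⊆T i∉T Θ'
                   F-holds frame sat =
    trans (eval-ext F λ { (inj₁ k) → sym (δ≗β k) ; (inj₂ _) → refl }) F-δ
    where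
    b : Bool
    b = not a

    γ-solution : Σ[ γ ∈ (Fin n → Bool) ]
                 SatisfiesDefs T' g γ w × (∀ j → ¬ j ∈ₛ T' → γ j ≡ (u [ i ]≔ b) j)
    γ-solution = solution-exists T' g acyclic' (u [ i ]≔ b) w

    γ : Fin n → Bool
    γ = proj₁ γ-solution

    γ-off : ∀ j → ¬ j ∈ₛ T' → γ j ≡ (u [ i ]≔ b) j
    γ-off = proj₂ (proj₂ γ-solution)

    δ : Fin n → Bool
    δ = γ [ i ]≔ b

    δ≗γ : δ ≗ γ
    δ≗γ = []≔-self (trans (γ-off i (i∉T ∘ T'⊆T i)) ([]≔-same u i b))

    F-δ : eval [ δ , w ]′ F ≡ true
    F-δ = Θ' γ F-holds
      (λ j j∉T' j≢i → sym (trans (γ-off j j∉T') ([]≔-other u b j≢i)))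
      (SatisfiesDefs-resp T' g (sym ∘ δ≗γ) (proj₁ (proj₂ γ-solution)))

    γ-agrees-off-T : ∀ j → ¬ j ∈ₛ T → j ≢ i → γ j ≡ u' j
    γ-agrees-off-T j j∉T j≢i = begin
      γ j             ≡⟨ γ-off j (j∉T ∘ T'⊆T j) ⟩
      (u [ i ]≔ b) j  ≡⟨ []≔-other u b j≢i ⟩
      u j             ≡⟨ frame j j∉T j≢i ⟩
      u' j            ∎
      where open ≡-Reasoning

    δ≗β : δ ≗ u' [ i ]≔ b
    δ≗β = solution-unique T g acyclic (isFunDefs⇒satisfiesDefs T g {F} fd F-δ) sat
            λ j j∉T → []≔-cong γ u' b (γ-agrees-off-T j j∉T)

lemma7 : {n m : ℕ} (F : Formula (Var n m)) (T T' : SubsetX n) (g : Defns n m)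
    → IsFunDefs F T g → Acyclic T g
    → IsFunDefs F T' g → Acyclic T' g
    → (∀ j → j ∈ₛ T' → j ∈ₛ T)
    → (i : Fin n) → T i ≡ false → (a : Bool)
    → Tautology (θ F T' g i a)
    → Tautology (θ F T g i a)
-- The f-defs of T' are among those of T, so they need not be assumed separately.
lemma7 F T T' g fd acyclic _ acyclic' T'⊆T i Tᵢ≡false a θ'-valid ρ =
  from (eval-θ F T g i a ρ)
    (Θ-from-subsystem F T T' g i a fd acyclic acyclic' T'⊆T (not-¬ Tᵢ≡false)
      λ v → to (eval-θ F T' g i a ⟨ ρ ∘ x , v , ρ ∘ y ⟩) (θ'-valid _))
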